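{- Let $k$ and $\ell$ be positive integers with $k\ge 3$. Then there exists a positive integer $N_2$ such that $px_{k,\ell}(K_{n,n})=2$ for every integer $n\ge N_2$.
   Context: All graphs are finite, simple and undirected; edge-colorings need not be proper. In an edge-colored graph, a tree $T$ is a proper tree if no two adjacent edges of $T$ receive the same color. For a connected graph $G$ and $S\subseteq V(G)$ with $|S|\ge 2$, an $S$-tree is a tree in $G$ containing all vertices of $S$. $S$-trees $T_1,\dots,T_\ell$ are internally disjoint if $E(T_i)\cap E(T_j)=\emptyset$ and $V(T_i)\cap V(T_j)=S$ for all $i\ne j$. For a $k$-subset $S$, $\kappa(S)$ is the maximum number of internally disjoint $S$-trees in $G$, and $\kappa_k(G)=\min\{\kappa(S): S\subseteq V(G),|S|=k\}$. For integers $2\le k\le |V(G)|$ and $1\le \ell\le \kappa_k(G)$, the $(k,\ell)$-proper index $px_{k,\ell}(G)$ is the minimum number of colors in an edge-coloring of $G$ such that for every $k$-subset $S$ of $V(G)$ there exist $\ell$ internally disjoint proper $S$-trees. $K_{m,n}$ denotes the complete bipartite graph with parts of sizes $m$ and $n$. -}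

module Defs where

open import Data.Nat using (ℕ; zero; suc; _+_; _<ᵇ_; _≤_)
open import Data.Fin using (Fin; zero; suc; toℕ; inject₁; fromℕ)
open import Data.Fin.Subset using (Subset; _∈_; ∣_∣; _⊆_)
open import Data.Bool using (Bool; true; false; _xor_)
open import Data.Product using (Σ; _×_; ∃; ∃-syntax; _,_)
open import Relation.Binary.PropositionalEquality using (_≡_; _≢_)
open import Relation.Nullary using (¬_)
open import Function.Definitions using (Injective)

-- A graph on the vertex set Fin m is given by a (symmetric, irreflexive)
-- Boolean adjacency relation.
Graph : ℕ → Set
Graph m = Fin m → Fin m → Bool

record Subgraph (m : ℕ) : Set where
  constructor subgraph
  field
    V : Subset m
    E : Fin m → Fin m → Bool
open Subgraph public

data Walk {m : ℕ} (E : Fin m → Fin m → Bool) : Fin m → Fin m → Set where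
  here : ∀ {u} → Walk E u u
  step : ∀ {u v w} → E u v ≡ true → Walk E v w → Walk E u w

record Cycle {m : ℕ} (E : Fin m → Fin m → Bool) : Set where
  field
    len   : ℕ
    vtx   : Fin (suc (suc (suc len))) → Fin m
    inj   : Injective _≡_ _≡_ vtx
    edges : ∀ (i : Fin (suc (suc len))) → E (vtx (inject₁ i)) (vtx (suc i)) ≡ true
    close : E (vtx (fromℕ (suc (suc len)))) (vtx zero) ≡ true

module _ {m : ℕ} (G : Graph m) where

  IsSubgraph : Subgraph m → Set
  IsSubgraph T = ∀ u v → E T u v ≡ true →
    (G u v ≡ true) × (u ∈ V T) × (v ∈ V T) × (E T v u ≡ true)

  Connected : Subgraph m → Set
  Connected T = ∀ u v → u ∈ V T → v ∈ V T → Walk (E T) u v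

  Acyclic : Subgraph m → Set
  Acyclic T = ¬ Cycle (E T)

  IsTree : Subgraph m → Set
  IsTree T = IsSubgraph T × Connected T × Acyclic T

  IsSTree : Subset m → Subgraph m → Set
  IsSTree S T = IsTree T × S ⊆ V T

  IsProper : ∀ {r} → (Fin m → Fin m → Fin r) → Subgraph m → Set
  IsProper c T = ∀ u v w → E T u v ≡ true → E T v w ≡ true → u ≢ w → c u v ≢ c v w

  InternallyDisjoint : ∀ {ℓ} → Subset m → (Fin ℓ → Subgraph m) → Set
  InternallyDisjoint S Ts = ∀ i j → i ≢ j →
    (∀ u v → E (Ts i) u v ≡ true → E (Ts j) u v ≡ false) ×
    (∀ x → x ∈ V (Ts i) → x ∈ V (Ts j) → x ∈ S)

  -- an edge-colouring with colours Fin r (symmetric, values off edges irrelevant)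
  -- such that every k-subset S admits ℓ internally disjoint proper S-trees
  PxColorable : ℕ → ℕ → ℕ → Set
  PxColorable k ℓ r = Σ (Fin m → Fin m → Fin r) λ c →
    (∀ u v → c u v ≡ c v u) ×
    (∀ (S : Subset m) → ∣ S ∣ ≡ k →
      Σ (Fin ℓ → Subgraph m) λ Ts →
        (∀ i → IsSTree S (Ts i) × IsProper c (Ts i)) × InternallyDisjoint S Ts)

  PxIs : ℕ → ℕ → ℕ → Set
  PxIs k ℓ p = PxColorable k ℓ p × (∀ r → PxColorable k ℓ r → p ≤ r)

-- complete bipartite graph K_{n,n} on Fin (n + n); parts {i < n} and {i ≥ n}
K : (n : ℕ) → Graph (n + n)
K n u v = (toℕ u <ᵇ n) xor (toℕ v <ᵇ n)

-- Colour an edge uv of K_{n,n} by the parity of u + v. An injective walk whose vertex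
-- parities follow the pattern 0,0,1,1,0,0,1,1,... then has edge colours 0,1,0,1,..., so it
-- is a proper path. Given a k-set S, for each of the ℓ trees we build such a path on 8k+1
-- positions alternating between the two parts: the j-th vertex of S sits in the j-th block of
-- eight positions, at one of its first four offsets, the one matching its part and parity; all
-- other positions get private vertices outside S, which exist once n ≥ 2ℓ(8k+1)(k+1).
-- Two of these paths meet only in S, and no two vertices of S are consecutive on a path, so the
-- paths share no edge. One colour never suffices: a monochromatic proper tree has maximum degree
-- one, hence at most two vertices, but it must contain three vertices of S.

module Submission where

open import Defs
open import Data.Nat using (ℕ; zero; suc; _+_; _*_; _≤_; _<_; z≤n; s≤s; _<ᵇ_)
import Data.Nat.Properties as ℕ
open import Data.Fin using (Fin; zero; suc; toℕ; inject₁; inject≤; fromℕ; _↑ˡ_; _↑ʳ_; combine)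
open import Data.Fin.Properties
  using (_≟_; all?; any?; ¬∀⟶∃¬; injective⇒≤; toℕ-injective; toℕ-inject₁; inject₁-injective;
         toℕ<n; toℕ-↑ˡ; toℕ-↑ʳ; ↑ˡ-injective; ↑ʳ-injective; toℕ-inject≤; inject≤-injective;
         toℕ-combine; combine-injective)
  renaming (suc-injective to fsuc-injective)
open import Data.Fin.Subset using (Subset; _∈_; _∉_; ∣_∣; _⊆_)
open import Data.Fin.Subset.Properties using (_∈?_)
open import Data.Vec using ([]; _∷_; tabulate)
open import Data.Vec.Properties using (lookup∘tabulate; []=⇒lookup; lookup⇒[]=)
open import Data.Bool using (Bool; true; false; not; _xor_)
open import Data.Bool.Properties using (¬-not; not-¬; not-involutive; not-distribʳ-xor; xor-inverseʳ; T-≡; not-distribˡ-xor; xor-same; xor-comm; xor-assoc)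
open import Data.Sum using (_⊎_; inj₁; inj₂)
open import Data.Product using (Σ; _×_; ∃; ∃-syntax; _,_; proj₁; proj₂)
open import Data.Empty using (⊥; ⊥-elim)
open import Function.Bundles using (Equivalence)
open import Function.Definitions using (Injective)
open import Function.Base using (_∘_)
open import Relation.Binary.PropositionalEquality using (_≡_; _≢_; refl; sym; trans; cong; cong₂; subst; module ≡-Reasoning)
open import Relation.Nullary using (¬_; Dec; yes; no; does; contradiction)
open import Relation.Nullary.Decidable using (dec-true; _×-dec_; _⊎-dec_)
open import Data.Vec.Base using (here; there)

Enumeration : ∀ {m} → Subset m → ℕ → Set
Enumeration {m} S k = Σ (Fin k → Fin m) λ x →
  Injective _≡_ _≡_ x × (∀ j → x j ∈ S) × (∀ v → v ∈ S → ∃ λ j → x j ≡ v)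

enumerate : ∀ {m} (S : Subset m) → Enumeration S ∣ S ∣
enumerate [] = (λ ()) , (λ {}) , (λ ()) , (λ ())
enumerate (true ∷ S) with enumerate S
... | x , x-inj , x-∈ , x-onto = x′ , x′-inj , x′-∈ , x′-onto
  where
  x′ : Fin (suc ∣ S ∣) → Fin _
  x′ zero = zero
  x′ (suc j) = suc (x j)
  x′-inj : Injective _≡_ _≡_ x′
  x′-inj {zero} {zero} _ = refl
  x′-inj {suc a} {suc b} e = cong suc (x-inj (fsuc-injective e))
  x′-∈ : ∀ j → x′ j ∈ (true ∷ S)
  x′-∈ zero = here
  x′-∈ (suc j) = there (x-∈ j)
  x′-onto : ∀ v → v ∈ (true ∷ S) → ∃ λ j → x′ j ≡ v
  x′-onto zero _ = zero , refl
  x′-onto (suc v) (there v∈S) with x-onto v v∈S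
  ... | j , refl = suc j , refl
enumerate (false ∷ S) with enumerate S
... | x , x-inj , x-∈ , x-onto =
  (λ j → suc (x j)) , (λ e → x-inj (fsuc-injective e)) , (λ j → there (x-∈ j)) , x′-onto
  where
  x′-onto : ∀ v → v ∈ (false ∷ S) → ∃ λ j → suc (x j) ≡ v
  x′-onto (suc v) (there v∈S) with x-onto v v∈S
  ... | j , refl = j , refl

enumerate-size : ∀ {m} (S : Subset m) {k} → ∣ S ∣ ≡ k → Enumeration S k
enumerate-size S refl = enumerate S

injective⇒∃∉ : ∀ {m k} (S : Subset m) → ∣ S ∣ ≡ k → (f : Fin (suc k) → Fin m) →
  Injective _≡_ _≡_ f → ∃ λ c → f c ∉ S
injective⇒∃∉ S |S|≡k f f-inj with all? (λ c → f c ∈? S)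
... | no ¬all = ¬∀⟶∃¬ _ _ (λ c → f c ∈? S) ¬all
... | yes all with enumerate-size S |S|≡k
... | x , _ , _ , x-onto = ⊥-elim (ℕ.1+n≰n (injective⇒≤ index-inj))
  where
  index : Fin (suc _) → Fin _
  index c = proj₁ (x-onto (f c) (all c))
  index-inj : Injective _≡_ _≡_ index
  index-inj {c} {c′} e = f-inj (trans (sym (proj₂ (x-onto (f c) (all c))))
                                (trans (cong x e) (proj₂ (x-onto (f c′) (all c′)))))

∃-subset-of-size : ∀ {m k} → k ≤ m → ∃ λ (S : Subset m) → ∣ S ∣ ≡ k
∃-subset-of-size {zero} z≤n = [] , refl
∃-subset-of-size {suc m} z≤n with ∃-subset-of-size {m} z≤n
... | S , |S| = false ∷ S , |S|
∃-subset-of-size {suc m} (s≤s k≤m) with ∃-subset-of-size k≤m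
... | S , |S| = true ∷ S , cong suc |S|

module _ {m} {E : Fin m → Fin m → Bool} where

  _++ʷ_ : ∀ {u v w} → Walk E u v → Walk E v w → Walk E u w
  here ++ʷ q = q
  step e p ++ʷ q = step e (p ++ʷ q)

  reverseʷ : (∀ u v → E u v ≡ true → E v u ≡ true) → ∀ {u v} → Walk E u v → Walk E v u
  reverseʷ sym-E here = here
  reverseʷ sym-E (step e p) = reverseʷ sym-E p ++ʷ step (sym-E _ _ e) here

walk-along : ∀ {m} {E : Fin m → Fin m → Bool} {L} (f : Fin (suc L) → Fin m) →
  (∀ p → E (f (inject₁ p)) (f (suc p)) ≡ true) → ∀ p → Walk E (f zero) (f p)
walk-along f f-edge zero = here
walk-along {L = suc L} f f-edge (suc p) = step (f-edge zero) (walk-along (λ q → f (suc q)) (λ q → f-edge (suc q)) p)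

argmax : ∀ {N} (g : Fin (suc N) → ℕ) → ∃ λ t → ∀ s → g s ≤ g t
argmax {zero} g = zero , λ { zero → ℕ.≤-refl }
argmax {suc N} g with argmax (λ s → g (suc s))
... | t , max with ℕ.≤-total (g zero) (g (suc t))
... | inj₁ le = suc t , λ { zero → le ; (suc s) → max s }
... | inj₂ ge = zero , λ { zero → ℕ.≤-refl ; (suc s) → ℕ.≤-trans (max s) ge }

last-or-inject₁ : ∀ {n} (s : Fin (suc n)) → (s ≡ fromℕ n) ⊎ (∃ λ s′ → s ≡ inject₁ s′)
last-or-inject₁ {zero} zero = inj₁ refl
last-or-inject₁ {suc n} zero = inj₂ (zero , refl)
last-or-inject₁ {suc n} (suc s) with last-or-inject₁ s
... | inj₁ e = inj₁ (cong suc e)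
... | inj₂ (s′ , e) = inj₂ (suc s′ , cong suc e)

module _ {m} {E : Fin m → Fin m → Bool} (C : Cycle E) where
  open Cycle C

  cycle-neighbours : ∀ t → ∃ λ a → ∃ λ b → a ≢ b × E (vtx a) (vtx t) ≡ true × E (vtx t) (vtx b) ≡ true
  cycle-neighbours zero = fromℕ (suc (suc len)) , suc zero , (λ ()) , close , edges zero
  cycle-neighbours (suc s) with last-or-inject₁ s
  ... | inj₁ refl = inject₁ s , zero , (λ ()) , edges s , close
  ... | inj₂ (s′ , refl) = inject₁ s , suc (suc s′) , inject₁²≢suc² , edges s , edges (suc s′)
    where
    inject₁²≢suc² : inject₁ (inject₁ s′) ≢ suc (suc s′)
    inject₁²≢suc² e = ℕ.m≢1+n+m (toℕ s′) {1} (trans (sym (trans (toℕ-inject₁ _) (toℕ-inject₁ s′))) (cong toℕ e))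

-- At a vertex of maximal height on a cycle, both cycle neighbours are lower.
acyclic-by-height : ∀ {m} {E : Fin m → Fin m → Bool} (h : Fin m → ℕ) →
  (∀ u v → E u v ≡ true → E v u ≡ true) →
  (∀ u v → E u v ≡ true → h u ≢ h v) →
  (∀ u v w → E u v ≡ true → E w v ≡ true → h u < h v → h w < h v → u ≡ w) →
  ¬ Cycle E
acyclic-by-height h sym-E h-≢ one-lower C with argmax (λ i → h (Cycle.vtx C i))
... | t , max with cycle-neighbours C t
... | a , b , a≢b , ea , eb with sym-E _ _ eb
... | eb′ = a≢b (Cycle.inj C (one-lower _ _ _ ea eb′ (ℕ.≤∧≢⇒< (max a) (h-≢ _ _ ea)) (ℕ.≤∧≢⇒< (max b) (h-≢ _ _ eb′))))

-- Paths as trees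

from-does : ∀ {P : Set} (p? : Dec P) → does p? ≡ true → P
from-does (yes p) _ = p

module PathTree {m} (G : Graph m) (G-sym : ∀ u v → G u v ≡ G v u) {L : ℕ}
  (π : Fin (suc L) → Fin m) (π-injective : Injective _≡_ _≡_ π)
  (π-adjacent : ∀ (p : Fin L) → G (π (inject₁ p)) (π (suc p)) ≡ true) where

  EdgeAt : Fin m → Fin m → Fin L → Set
  EdgeAt u v p = (π (inject₁ p) ≡ u × π (suc p) ≡ v) ⊎ (π (suc p) ≡ u × π (inject₁ p) ≡ v)

  edge? : ∀ u v → Dec (∃ (EdgeAt u v))
  edge? u v = any? λ p → ((π (inject₁ p) ≟ u) ×-dec (π (suc p) ≟ v)) ⊎-dec ((π (suc p) ≟ u) ×-dec (π (inject₁ p) ≟ v))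

  onPath? : ∀ v → Dec (∃ λ p → π p ≡ v)
  onPath? v = any? λ p → π p ≟ v

  tree : Subgraph m
  tree = subgraph (tabulate λ v → does (onPath? v)) (λ u v → does (edge? u v))

  ∈-tree : ∀ p → π p ∈ V tree
  ∈-tree p = lookup⇒[]= (π p) _ (trans (lookup∘tabulate _ (π p)) (dec-true (onPath? (π p)) (p , refl)))

  ∈-tree⁻ : ∀ v → v ∈ V tree → ∃ λ p → π p ≡ v
  ∈-tree⁻ v v∈ = from-does (onPath? v) (trans (sym (lookup∘tabulate _ v)) ([]=⇒lookup v∈))

  edge⁻ : ∀ {u v} → E tree u v ≡ true → ∃ (EdgeAt u v)
  edge⁻ {u} {v} = from-does (edge? u v)

  edge-sym : ∀ u v → E tree u v ≡ true → E tree v u ≡ true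
  edge-sym u v uv with edge⁻ uv
  ... | p , inj₁ (a , b) = dec-true (edge? v u) (p , inj₂ (b , a))
  ... | p , inj₂ (a , b) = dec-true (edge? v u) (p , inj₁ (b , a))

  edge-at : ∀ (p : Fin L) → E tree (π (inject₁ p)) (π (suc p)) ≡ true
  edge-at p = dec-true (edge? _ _) (p , inj₁ (refl , refl))

  isSubgraph : IsSubgraph G tree
  isSubgraph u v uv with edge⁻ uv
  ... | p , inj₁ (refl , refl) = π-adjacent p , ∈-tree _ , ∈-tree _ , edge-sym u v uv
  ... | p , inj₂ (refl , refl) = trans (G-sym _ _) (π-adjacent p) , ∈-tree _ , ∈-tree _ , edge-sym u v uv

  connected : Connected G tree
  connected u v u∈ v∈ with ∈-tree⁻ u u∈ | ∈-tree⁻ v v∈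
  ... | p , refl | q , refl = reverseʷ edge-sym (walk-along π edge-at p) ++ʷ walk-along π edge-at q

  position : Fin m → ℕ
  position v with onPath? v
  ... | yes (p , _) = toℕ p
  ... | no _ = 0

  position-π : ∀ p → position (π p) ≡ toℕ p
  position-π p with onPath? (π p)
  ... | yes (q , e) = cong toℕ (π-injective e)
  ... | no ∉ = ⊥-elim (∉ (p , refl))

  position-suc : ∀ (p : Fin L) → position (π (suc p)) ≡ suc (position (π (inject₁ p)))
  position-suc p = trans (position-π (suc p)) (cong suc (sym (trans (position-π (inject₁ p)) (toℕ-inject₁ p))))

  position-≢ : ∀ u v → E tree u v ≡ true → position u ≢ position v
  position-≢ u v uv with edge⁻ uv
  ... | p , inj₁ (refl , refl) = λ e → ℕ.1+n≢n (sym (trans e (position-suc p)))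
  ... | p , inj₂ (refl , refl) = λ e → ℕ.1+n≢n (sym (trans (sym e) (position-suc p)))

  edge-upward : ∀ {u v} → E tree u v ≡ true → position u < position v →
    ∃ λ (p : Fin L) → π (inject₁ p) ≡ u × π (suc p) ≡ v
  edge-upward uv u<v with edge⁻ uv
  ... | p , inj₁ e = p , e
  ... | p , inj₂ (refl , refl) =
    ⊥-elim (ℕ.<-asym u<v (subst (position (π (inject₁ p)) <_) (sym (position-suc p)) (ℕ.n<1+n _)))

  one-lower-neighbour : ∀ u v w → E tree u v ≡ true → E tree w v ≡ true →
    position u < position v → position w < position v → u ≡ w
  one-lower-neighbour u v w uv wv u<v w<v with edge-upward uv u<v | edge-upward wv w<v
  ... | p , refl , refl | q , refl , e = cong (λ r → π (inject₁ r)) (fsuc-injective (π-injective (sym e)))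

  isTree : IsTree G tree
  isTree = isSubgraph , connected , acyclic-by-height position edge-sym position-≢ one-lower-neighbour

  isProper : ∀ {r} (c : Fin m → Fin m → Fin r) → (∀ u v → c u v ≡ c v u) →
    (∀ (p q : Fin L) → suc p ≡ inject₁ q → c (π (inject₁ p)) (π (suc p)) ≢ c (π (inject₁ q)) (π (suc q))) →
    IsProper G c tree
  isProper c c-sym alternating u v w uv vw u≢w with edge⁻ uv | edge⁻ vw
  ... | p , inj₁ (refl , refl) | q , inj₁ (e , refl) =
    subst (λ z → c u v ≢ c z w) e (alternating p q (sym (π-injective e)))
  ... | p , inj₁ (refl , refl) | q , inj₂ (e , refl) =
    ⊥-elim (u≢w (cong (λ r → π (inject₁ r)) (fsuc-injective (π-injective (sym e)))))
  ... | p , inj₂ (refl , refl) | q , inj₁ (e , refl) =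
    ⊥-elim (u≢w (cong (λ r → π (suc r)) (inject₁-injective (π-injective (sym e)))))
  ... | p , inj₂ (refl , refl) | q , inj₂ (e , refl) = λ same →
    alternating q p (π-injective e)
      (trans (cong (c w) e) (trans (c-sym _ _) (trans (sym same) (c-sym _ _))))

module PathTrees {m} (G : Graph m) (G-sym : ∀ u v → G u v ≡ G v u) {ℓ L : ℕ}
  (π : Fin ℓ → Fin (suc L) → Fin m) (π-injective : ∀ i → Injective _≡_ _≡_ (π i))
  (π-adjacent : ∀ i (p : Fin L) → G (π i (inject₁ p)) (π i (suc p)) ≡ true) where

  module Path (i : Fin ℓ) = PathTree G G-sym (π i) (π-injective i) (π-adjacent i)

  trees : Fin ℓ → Subgraph m
  trees i = Path.tree i

  internallyDisjoint : (S : Subset m) →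
    (∀ i i′ t t′ → i ≢ i′ → π i t ≡ π i′ t′ → π i t ∈ S) →
    (∀ i (p : Fin L) → π i (inject₁ p) ∈ S → π i (suc p) ∈ S → ⊥) →
    InternallyDisjoint G S trees
  internallyDisjoint S shared-∈ no-consecutive-∈ i i′ i≢i′ = edge-disjoint , vertex-disjoint
    where
    vertex-disjoint : ∀ x → x ∈ V (trees i) → x ∈ V (trees i′) → x ∈ S
    vertex-disjoint x x∈ x∈′ with Path.∈-tree⁻ i x x∈ | Path.∈-tree⁻ i′ x x∈′
    ... | t , refl | t′ , e = shared-∈ i i′ t t′ i≢i′ (sym e)

    edge-disjoint : ∀ u v → E (trees i) u v ≡ true → E (trees i′) u v ≡ false
    edge-disjoint u v uv = ¬-not λ uv′ → both-in-S (Path.edge⁻ i uv)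
        (in-S (proj₁ (proj₂ (Path.isSubgraph i u v uv))) (proj₁ (proj₂ (Path.isSubgraph i′ u v uv′))))
        (in-S (proj₁ (proj₂ (proj₂ (Path.isSubgraph i u v uv)))) (proj₁ (proj₂ (proj₂ (Path.isSubgraph i′ u v uv′)))))
      where
      in-S : ∀ {x} → x ∈ V (trees i) → x ∈ V (trees i′) → x ∈ S
      in-S = vertex-disjoint _
      both-in-S : ∃ (Path.EdgeAt i u v) → u ∈ S → v ∈ S → ⊥
      both-in-S (p , inj₁ (refl , refl)) u∈ v∈ = no-consecutive-∈ i p u∈ v∈
      both-in-S (p , inj₂ (refl , refl)) u∈ v∈ = no-consecutive-∈ i p v∈ u∈

-- One colour is not enough

-- With a single colour, properness forces every vertex of T to have at most one neighbour in T.
module MonochromaticTree {m} (G : Graph m) (c : Fin m → Fin m → Fin 1) (T : Subgraph m)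
  (sub : IsSubgraph G T) (proper : IsProper G c T) where

  edge-sym : ∀ u v → E T u v ≡ true → E T v u ≡ true
  edge-sym u v uv = proj₂ (proj₂ (proj₂ (sub u v uv)))

  unique-neighbour : ∀ u v w → E T u v ≡ true → E T v w ≡ true → u ≡ w
  unique-neighbour u v w uv vw with u ≟ w
  ... | yes u≡w = u≡w
  ... | no u≢w = ⊥-elim (proper u v w uv vw u≢w (single-colour _ _))
    where
    single-colour : ∀ (x y : Fin 1) → x ≡ y
    single-colour zero zero = refl

  stays-on-edge : ∀ {a v} → E T a v ≡ true → ∀ {y z} → Walk (E T) y z → y ≡ a ⊎ y ≡ v → z ≡ a ⊎ z ≡ v
  stays-on-edge av here y-on = y-on
  stays-on-edge av (step e p) (inj₁ refl) = stays-on-edge av p (inj₂ (unique-neighbour _ _ _ (edge-sym _ _ e) av))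
  stays-on-edge av (step e p) (inj₂ refl) = stays-on-edge av p (inj₁ (sym (unique-neighbour _ _ _ av e)))

  first-step : ∀ {a b} → a ≢ b → Walk (E T) a b → ∃ λ v → E T a v ≡ true × b ≡ v
  first-step a≢b here = ⊥-elim (a≢b refl)
  first-step a≢b (step {v = v} av p) with stays-on-edge av p (inj₂ refl)
  ... | inj₁ b≡a = ⊥-elim (a≢b (sym b≡a))
  ... | inj₂ b≡v = v , av , b≡v

  no-three-vertices : Connected G T → ∀ a b d → a ∈ V T → b ∈ V T → d ∈ V T → a ≢ b → a ≢ d → b ≢ d → ⊥
  no-three-vertices conn a b d a∈ b∈ d∈ a≢b a≢d b≢d
    with first-step a≢b (conn a b a∈ b∈) | first-step a≢d (conn a d a∈ d∈)
  ... | v , av , refl | v′ , av′ , refl = b≢d (unique-neighbour v a v′ (edge-sym a v av) av′)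

two-colours-necessary : ∀ {m} (G : Graph m) {k ℓ r} → 3 ≤ k → 1 ≤ ℓ → k ≤ m → PxColorable G k ℓ r → 2 ≤ r
two-colours-necessary G {r = suc (suc r)} _ _ _ _ = s≤s (s≤s z≤n)
two-colours-necessary G {r = zero} 3≤k _ k≤m (c , _) with ℕ.≤-trans 3≤k k≤m
... | s≤s _ with c zero zero
... | ()
two-colours-necessary G {suc (suc (suc k))} {suc ℓ} {suc zero} (s≤s (s≤s (s≤s _))) _ k≤m (c , _ , trees-for)
  with ∃-subset-of-size k≤m
... | S , |S|≡k with enumerate-size S |S|≡k | trees-for S |S|≡k
... | x , x-inj , x-∈ , _ | Ts , Ts-good , _ with Ts-good zero
... | ((T-isSubgraph , T-connected , _) , S⊆T) , T-proper =
  ⊥-elim (MonochromaticTree.no-three-vertices G c (Ts zero) T-isSubgraph T-proper T-connected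
    (x zero) (x (suc zero)) (x (suc (suc zero))) (S⊆T (x-∈ _)) (S⊆T (x-∈ _)) (S⊆T (x-∈ _))
    (λ e → contradiction (x-inj e) λ ()) (λ e → contradiction (x-inj e) λ ()) (λ e → contradiction (x-inj e) λ ()))

-- The parity colouring of K n

odd : ℕ → Bool
odd zero = false
odd (suc n) = not (odd n)

odd-+ : ∀ a b → odd (a + b) ≡ odd a xor odd b
odd-+ zero b = refl
odd-+ (suc a) b = trans (cong not (odd-+ a b)) (not-distribˡ-xor (odd a) (odd b))

odd-2* : ∀ a → odd (2 * a) ≡ false
odd-2* a = trans (odd-+ a (a + 0)) (trans (cong (λ b → odd a xor odd b) (ℕ.+-identityʳ a)) (xor-same (odd a)))

bit : Bool → Fin 2
bit false = zero
bit true = suc zero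

bit-injective : ∀ {a b} → bit a ≡ bit b → a ≡ b
bit-injective {false} {false} _ = refl
bit-injective {true} {true} _ = refl

odd-bit : ∀ b → odd (toℕ (bit b)) ≡ b
odd-bit false = refl
odd-bit true = refl

module Bipartite (n : ℕ) where

  side : Fin (n + n) → Bool
  side v = toℕ v <ᵇ n

  parity : Fin (n + n) → Bool
  parity v = odd (toℕ v)

  parityColouring : Fin (n + n) → Fin (n + n) → Fin 2
  parityColouring u v = bit (parity u xor parity v)

  parityColouring-sym : ∀ u v → parityColouring u v ≡ parityColouring v u
  parityColouring-sym u v = cong bit (xor-comm (parity u) (parity v))

  K-sym : ∀ u v → K n u v ≡ K n v u
  K-sym u v = xor-comm (side u) (side v)

  side-↑ˡ : ∀ (i : Fin n) → side (i ↑ˡ n) ≡ true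
  side-↑ˡ i = trans (cong (_<ᵇ n) (toℕ-↑ˡ i n)) (Equivalence.to T-≡ (ℕ.<⇒<ᵇ (toℕ<n i)))

  side-↑ʳ : ∀ (i : Fin n) → side (n ↑ʳ i) ≡ false
  side-↑ʳ i = trans (cong (_<ᵇ n) (toℕ-↑ʳ n i)) (+<ᵇ n (toℕ i))
    where
    +<ᵇ : ∀ a b → ((a + b) <ᵇ a) ≡ false
    +<ᵇ zero b = refl
    +<ᵇ (suc a) b = +<ᵇ a b

  module TypedVertices (Q : ℕ) (room : Q * 2 ≤ n) where

    indexInPart : Fin Q → Bool → Fin n
    indexInPart q b = inject≤ (combine q (bit b)) room

    odd-indexInPart : ∀ q b → odd (toℕ (indexInPart q b)) ≡ b
    odd-indexInPart q b = begin
      odd (toℕ (indexInPart q b))           ≡⟨ cong odd (trans (toℕ-inject≤ _ room) (toℕ-combine q (bit b))) ⟩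
      odd (2 * toℕ q + toℕ (bit b))         ≡⟨ odd-+ (2 * toℕ q) _ ⟩
      odd (2 * toℕ q) xor odd (toℕ (bit b)) ≡⟨ cong₂ _xor_ (odd-2* (toℕ q)) (odd-bit b) ⟩
      b                                     ∎
      where open ≡-Reasoning

    indexInPart-injective : ∀ {q b q′ b′} → indexInPart q b ≡ indexInPart q′ b′ → q ≡ q′
    indexInPart-injective {q} {b} {q′} {b′} e =
      proj₁ (combine-injective q (bit b) q′ (bit b′) (inject≤-injective room room _ _ e))

    vertexOfType : Bool → Bool → Fin Q → Fin (n + n)
    vertexOfType true p q = indexInPart q p ↑ˡ n
    vertexOfType false p q = n ↑ʳ indexInPart q (odd n xor p)

    side-vertexOfType : ∀ s p q → side (vertexOfType s p q) ≡ s
    side-vertexOfType true p q = side-↑ˡ _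
    side-vertexOfType false p q = side-↑ʳ _

    parity-vertexOfType : ∀ s p q → parity (vertexOfType s p q) ≡ p
    parity-vertexOfType true p q = trans (cong odd (toℕ-↑ˡ (indexInPart q p) n)) (odd-indexInPart q p)
    parity-vertexOfType false p q = begin
      odd (toℕ (n ↑ʳ indexInPart q (odd n xor p)))        ≡⟨ cong odd (toℕ-↑ʳ n _) ⟩
      odd (n + toℕ (indexInPart q (odd n xor p)))         ≡⟨ odd-+ n _ ⟩
      odd n xor odd (toℕ (indexInPart q (odd n xor p)))   ≡⟨ cong (odd n xor_) (odd-indexInPart q (odd n xor p)) ⟩
      odd n xor (odd n xor p)                             ≡⟨ sym (xor-assoc (odd n) (odd n) p) ⟩
      (odd n xor odd n) xor p                             ≡⟨ cong (_xor p) (xor-same (odd n)) ⟩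
      p                                                   ∎
      where open ≡-Reasoning

    vertexOfType-injective : ∀ {s p q s′ p′ q′} → vertexOfType s p q ≡ vertexOfType s′ p′ q′ → q ≡ q′
    vertexOfType-injective {s} {p} {q} {s′} {p′} {q′} e
      with trans (sym (side-vertexOfType s p q)) (trans (cong side e) (side-vertexOfType s′ p′ q′))
         | trans (sym (parity-vertexOfType s p q)) (trans (cong parity e) (parity-vertexOfType s′ p′ q′))
    ... | refl | refl = same-type s e
      where
      same-type : ∀ s → vertexOfType s p q ≡ vertexOfType s p q′ → q ≡ q′
      same-type true e = indexInPart-injective (↑ˡ-injective n _ _ e)
      same-type false e = indexInPart-injective (↑ʳ-injective n _ _ e)

oddHalf : ℕ → Bool
oddHalf 0 = false
oddHalf 1 = false
oddHalf (suc (suc t)) = not (oddHalf t)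

periodic : ∀ d (f : ℕ → Bool) → (∀ x → f (d + x) ≡ f x) → ∀ j r → f (d * j + r) ≡ f r
periodic d f f-per zero r = cong (λ a → f (a + r)) (ℕ.*-zeroʳ d)
periodic d f f-per (suc j) r = begin
  f (d * suc j + r)   ≡⟨ cong (λ a → f (a + r)) (ℕ.*-suc d j) ⟩
  f (d + d * j + r)   ≡⟨ cong f (ℕ.+-assoc d (d * j) r) ⟩
  f (d + (d * j + r)) ≡⟨ f-per _ ⟩
  f (d * j + r)       ≡⟨ periodic d f f-per j r ⟩
  f r                 ∎
  where open ≡-Reasoning

odd-periodic : ∀ j r → odd (8 * j + r) ≡ odd r
odd-periodic = periodic 8 odd λ x → odd-+ 8 x

oddHalf-periodic : ∀ j r → oddHalf (8 * j + r) ≡ oddHalf r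
oddHalf-periodic = periodic 8 oddHalf λ x → trans (not-involutive _) (not-involutive _)

-- The colour of the t-th edge of the paths built below.
edgeColour : ℕ → Fin 2
edgeColour t = bit (oddHalf t xor oddHalf (suc t))

edgeColour-alternates : ∀ t → edgeColour t ≢ edgeColour (suc t)
edgeColour-alternates t e = not-¬ refl (bit-injective (trans e (cong bit (begin
  b xor not a   ≡⟨ sym (not-distribʳ-xor b a) ⟩
  not (b xor a) ≡⟨ cong not (xor-comm b a) ⟩
  not (a xor b) ∎))))
  where
  open ≡-Reasoning
  a b : Bool
  a = oddHalf t
  b = oddHalf (suc t)

offset : Bool → Bool → Fin 4
offset false false = zero
offset true false = suc zero
offset false true = suc (suc zero)
offset true true = suc (suc (suc zero))

odd-offset : ∀ s p → odd (toℕ (offset s p)) ≡ s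
odd-offset false false = refl
odd-offset true false = refl
odd-offset false true = refl
odd-offset true true = refl

oddHalf-offset : ∀ s p → oddHalf (toℕ (offset s p)) ≡ p
oddHalf-offset false false = refl
oddHalf-offset true false = refl
oddHalf-offset false true = refl
oddHalf-offset true true = refl

-- Internally disjoint proper S-trees in K n

module Construction (n k ℓ : ℕ) (S : Subset (n + n)) (|S|≡k : ∣ S ∣ ≡ k)
  (room : ℓ * suc (k * 8) * suc k * 2 ≤ n) where

  open Bipartite n
  open TypedVertices (ℓ * suc (k * 8) * suc k) room

  Position : Set
  Position = Fin (suc (k * 8))

  -- Each (path, position) pair owns k + 1 candidate vertices of the right type; one avoids S.
  candidate : Fin ℓ → Position → Fin (suc k) → Fin (n + n)
  candidate i t c = vertexOfType (odd (toℕ t)) (oddHalf (toℕ t)) (combine (combine i t) c)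

  candidate-injective : ∀ {i t c i′ t′ c′} → candidate i t c ≡ candidate i′ t′ c′ → (i ≡ i′ × t ≡ t′) × c ≡ c′
  candidate-injective {i} {t} {c} {i′} {t′} {c′} e
    with combine-injective _ c _ c′ (vertexOfType-injective {odd (toℕ t)} {oddHalf (toℕ t)} {_} {odd (toℕ t′)} {oddHalf (toℕ t′)} e)
  ... | it≡ , c≡ = combine-injective i t i′ t′ it≡ , c≡

  filler-choice : ∀ i t → ∃ λ c → candidate i t c ∉ S
  filler-choice i t = injective⇒∃∉ S |S|≡k (candidate i t) (λ e → proj₂ (candidate-injective {i} {t} {_} {i} {t} e))

  filler : Fin ℓ → Position → Fin (n + n)
  filler i t = candidate i t (proj₁ (filler-choice i t))

  filler-∉ : ∀ i t → filler i t ∉ S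
  filler-∉ i t = proj₂ (filler-choice i t)

  filler-injective : ∀ {i t i′ t′} → filler i t ≡ filler i′ t′ → i ≡ i′ × t ≡ t′
  filler-injective {i} {t} {i′} {t′} e = proj₁ (candidate-injective {i} {t} {_} {i′} {t′} e)

  side-filler : ∀ i t → side (filler i t) ≡ odd (toℕ t)
  side-filler i t = side-vertexOfType (odd (toℕ t)) (oddHalf (toℕ t)) _

  parity-filler : ∀ i t → parity (filler i t) ≡ oddHalf (toℕ t)
  parity-filler i t = parity-vertexOfType (odd (toℕ t)) (oddHalf (toℕ t)) _

  x : Fin k → Fin (n + n)
  x = proj₁ (enumerate-size S |S|≡k)

  x-injective : Injective _≡_ _≡_ x
  x-injective = proj₁ (proj₂ (enumerate-size S |S|≡k))

  x-∈ : ∀ j → x j ∈ S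
  x-∈ = proj₁ (proj₂ (proj₂ (enumerate-size S |S|≡k)))

  x-onto : ∀ v → v ∈ S → ∃ λ j → x j ≡ v
  x-onto = proj₂ (proj₂ (proj₂ (enumerate-size S |S|≡k)))

  -- Offsets below 4 within blocks of 8 keep the slots of S pairwise non-consecutive.
  offsetOf : Fin k → Fin 4
  offsetOf j = offset (side (x j)) (parity (x j))

  slot : Fin k → Position
  slot j = inject₁ (combine j (offsetOf j ↑ˡ 4))

  toℕ-slot : ∀ j → toℕ (slot j) ≡ 8 * toℕ j + toℕ (offsetOf j)
  toℕ-slot j = trans (toℕ-inject₁ _) (trans (toℕ-combine j _) (cong (8 * toℕ j +_) (toℕ-↑ˡ (offsetOf j) 4)))

  slot-injective : Injective _≡_ _≡_ slot
  slot-injective e = proj₁ (combine-injective _ _ _ _ (inject₁-injective e))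

  odd-slot : ∀ j → odd (toℕ (slot j)) ≡ side (x j)
  odd-slot j = trans (cong odd (toℕ-slot j)) (trans (odd-periodic (toℕ j) _) (odd-offset (side (x j)) (parity (x j))))

  oddHalf-slot : ∀ j → oddHalf (toℕ (slot j)) ≡ parity (x j)
  oddHalf-slot j = trans (cong oddHalf (toℕ-slot j)) (trans (oddHalf-periodic (toℕ j) _) (oddHalf-offset (side (x j)) (parity (x j))))

  slots-not-consecutive : ∀ j j′ → suc (toℕ (slot j)) ≢ toℕ (slot j′)
  slots-not-consecutive j j′ e
    with combine-injective j (suc (offsetOf j) ↑ˡ 3) j′ (offsetOf j′ ↑ˡ 4) (toℕ-injective (begin
      toℕ (combine j (suc (offsetOf j) ↑ˡ 3))         ≡⟨ toℕ-combine j _ ⟩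
      8 * toℕ j + toℕ (suc (offsetOf j) ↑ˡ 3)         ≡⟨ cong (8 * toℕ j +_) (toℕ-↑ˡ (suc (offsetOf j)) 3) ⟩
      8 * toℕ j + suc (toℕ (offsetOf j))              ≡⟨ ℕ.+-suc (8 * toℕ j) _ ⟩
      suc (8 * toℕ j + toℕ (offsetOf j))              ≡⟨ cong suc (sym (toℕ-slot j)) ⟩
      suc (toℕ (slot j))                              ≡⟨ e ⟩
      toℕ (slot j′)                                   ≡⟨ toℕ-inject₁ _ ⟩
      toℕ (combine j′ (offsetOf j′ ↑ˡ 4))             ∎))
    where open ≡-Reasoning
  ... | refl , e′ = ℕ.1+n≢n (trans (sym (toℕ-↑ˡ (suc (offsetOf j)) 3)) (trans (cong toℕ e′) (toℕ-↑ˡ (offsetOf j) 4)))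

  slot? : ∀ t → Dec (∃ λ j → slot j ≡ t)
  slot? t = any? λ j → slot j ≟ t

  π : Fin ℓ → Position → Fin (n + n)
  π i t with slot? t
  ... | yes (j , _) = x j
  ... | no _ = filler i t

  π-view : ∀ i t → (∃ λ j → slot j ≡ t × π i t ≡ x j) ⊎ ((¬ ∃ λ j → slot j ≡ t) × π i t ≡ filler i t)
  π-view i t with slot? t
  ... | yes (j , e) = inj₁ (j , e , refl)
  ... | no ¬slot = inj₂ (¬slot , refl)

  side-π : ∀ i t → side (π i t) ≡ odd (toℕ t)
  side-π i t with π-view i t
  ... | inj₁ (j , refl , e) = trans (cong side e) (sym (odd-slot j))
  ... | inj₂ (_ , e) = trans (cong side e) (side-filler i t)

  parity-π : ∀ i t → parity (π i t) ≡ oddHalf (toℕ t)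
  parity-π i t with π-view i t
  ... | inj₁ (j , refl , e) = trans (cong parity e) (sym (oddHalf-slot j))
  ... | inj₂ (_ , e) = trans (cong parity e) (parity-filler i t)

  π-slot : ∀ i j → π i (slot j) ≡ x j
  π-slot i j with π-view i (slot j)
  ... | inj₁ (j′ , e , e′) = trans e′ (cong x (slot-injective e))
  ... | inj₂ (¬slot , _) = ⊥-elim (¬slot (j , refl))

  π-∈ : ∀ {i t} → π i t ∈ S → ∃ λ j → slot j ≡ t
  π-∈ {i} {t} π∈S with π-view i t
  ... | inj₁ (j , e , _) = j , e
  ... | inj₂ (_ , e) = ⊥-elim (filler-∉ i t (subst (_∈ S) e π∈S))

  π-injective : ∀ i → Injective _≡_ _≡_ (π i)
  π-injective i {t} {t′} e with π-view i t | π-view i t′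
  ... | inj₁ (j , refl , e₁) | inj₁ (j′ , refl , e₂) = cong slot (x-injective (trans (sym e₁) (trans e e₂)))
  ... | inj₁ (j , _ , e₁) | inj₂ (_ , e₂) = ⊥-elim (filler-∉ i t′ (subst (_∈ S) (trans (sym e₁) (trans e e₂)) (x-∈ j)))
  ... | inj₂ (_ , e₁) | inj₁ (j , _ , e₂) = ⊥-elim (filler-∉ i t (subst (_∈ S) (trans (sym e₂) (trans (sym e) e₁)) (x-∈ j)))
  ... | inj₂ (_ , e₁) | inj₂ (_ , e₂) = proj₂ (filler-injective {i} {t} {i} {t′} (trans (sym e₁) (trans e e₂)))

  π-shared-∈ : ∀ i i′ t t′ → i ≢ i′ → π i t ≡ π i′ t′ → π i t ∈ S
  π-shared-∈ i i′ t t′ i≢i′ e with π-view i t | π-view i′ t′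
  ... | inj₁ (j , _ , e₁) | _ = subst (_∈ S) (sym e₁) (x-∈ j)
  ... | inj₂ _ | inj₁ (j , _ , e₂) = subst (_∈ S) (trans (sym e₂) (sym e)) (x-∈ j)
  ... | inj₂ (_ , e₁) | inj₂ (_ , e₂) = ⊥-elim (i≢i′ (proj₁ (filler-injective {i} {t} {i′} {t′} (trans (sym e₁) (trans e e₂)))))

  π-no-consecutive-∈ : ∀ i (p : Fin (k * 8)) → π i (inject₁ p) ∈ S → π i (suc p) ∈ S → ⊥
  π-no-consecutive-∈ i p ∈₁ ∈₂ with π-∈ ∈₁ | π-∈ ∈₂
  ... | j , e₁ | j′ , e₂ = slots-not-consecutive j j′ (begin
    suc (toℕ (slot j))         ≡⟨ cong (suc ∘ toℕ) e₁ ⟩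
    suc (toℕ (inject₁ p))      ≡⟨ cong suc (toℕ-inject₁ p) ⟩
    toℕ (suc p)                ≡⟨ cong toℕ (sym e₂) ⟩
    toℕ (slot j′)              ∎)
    where open ≡-Reasoning

  π-adjacent : ∀ i (p : Fin (k * 8)) → K n (π i (inject₁ p)) (π i (suc p)) ≡ true
  π-adjacent i p = begin
    side (π i (inject₁ p)) xor side (π i (suc p))  ≡⟨ cong₂ _xor_ (side-π i (inject₁ p)) (side-π i (suc p)) ⟩
    odd (toℕ (inject₁ p)) xor not (odd (toℕ p))     ≡⟨ cong (λ a → odd a xor not (odd (toℕ p))) (toℕ-inject₁ p) ⟩
    odd (toℕ p) xor not (odd (toℕ p))               ≡⟨ xor-inverseʳ (odd (toℕ p)) ⟩
    true                                            ∎
    where open ≡-Reasoning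

  colour-π : ∀ i (p : Fin (k * 8)) → parityColouring (π i (inject₁ p)) (π i (suc p)) ≡ edgeColour (toℕ p)
  colour-π i p = cong bit (cong₂ _xor_ (trans (parity-π i (inject₁ p)) (cong oddHalf (toℕ-inject₁ p))) (parity-π i (suc p)))

  colour-π-alternates : ∀ i (p q : Fin (k * 8)) → suc p ≡ inject₁ q →
    parityColouring (π i (inject₁ p)) (π i (suc p)) ≢ parityColouring (π i (inject₁ q)) (π i (suc q))
  colour-π-alternates i p q e same = edgeColour-alternates (toℕ p) (begin
    edgeColour (toℕ p)        ≡⟨ sym (colour-π i p) ⟩
    parityColouring (π i (inject₁ p)) (π i (suc p)) ≡⟨ same ⟩
    parityColouring (π i (inject₁ q)) (π i (suc q)) ≡⟨ colour-π i q ⟩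
    edgeColour (toℕ q)        ≡⟨ cong edgeColour (trans (sym (toℕ-inject₁ q)) (cong toℕ (sym e))) ⟩
    edgeColour (suc (toℕ p))  ∎)
    where open ≡-Reasoning

  open PathTrees (K n) K-sym π π-injective π-adjacent

  internallyDisjointProperSTrees :
    Σ (Fin ℓ → Subgraph (n + n)) λ Ts →
      (∀ i → IsSTree (K n) S (Ts i) × IsProper (K n) parityColouring (Ts i)) × InternallyDisjoint (K n) S Ts
  internallyDisjointProperSTrees =
    trees , (λ i → (Path.isTree i , S⊆tree i) , Path.isProper i parityColouring parityColouring-sym (colour-π-alternates i)) ,
    internallyDisjoint S π-shared-∈ π-no-consecutive-∈
    where
    S⊆tree : ∀ i → S ⊆ V (trees i)
    S⊆tree i {v} v∈S with x-onto v v∈S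
    ... | j , refl = subst (_∈ V (trees i)) (π-slot i j) (Path.∈-tree i (slot j))

theorem3p1 : ∀ (k ℓ : ℕ) → 3 ≤ k → 1 ≤ ℓ →
    ∃[ N₂ ] (1 ≤ N₂ × (∀ (n : ℕ) → N₂ ≤ n → PxIs (K n) k ℓ 2))
theorem3p1 k (suc ℓ) 3≤k 1≤ℓ = N₂ , ℕ.≤-trans (ℕ.≤-trans (s≤s z≤n) 3≤k) k≤N₂ , λ n N₂≤n →
  let open Bipartite n in
  (parityColouring , parityColouring-sym , λ S |S|≡k → Construction.internallyDisjointProperSTrees n k (suc ℓ) S |S|≡k N₂≤n) ,
  λ r → two-colours-necessary (K n) 3≤k 1≤ℓ (ℕ.≤-trans k≤N₂ (ℕ.≤-trans N₂≤n (ℕ.m≤m+n n n)))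
  where
  N₂ : ℕ
  N₂ = suc ℓ * suc (k * 8) * suc k * 2
  k≤N₂ : k ≤ N₂
  k≤N₂ = ℕ.≤-trans (ℕ.n≤1+n k) (ℕ.≤-trans (ℕ.m≤n*m (suc k) (suc ℓ * suc (k * 8))) (ℕ.m≤m*n _ 2))
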